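{- Let $n \geq 5$ and $p \geq 3$. In the $p$-player Zeckendorf game starting from $n$ copies of $1$, no player has a winning strategy.
   Context: Let $F_1=1$, $F_2=2$, $F_{i+1}=F_i+F_{i-1}$ (so $F_3=3$, $F_4=5,\dots$). The Zeckendorf game on $n$ starts with the unordered list (multiset) consisting of $n$ copies of $F_1=1$. A move is one of: (1) if the list contains $F_{i-1}$ and $F_i$, replace them by $F_{i+1}$; (2) if the list contains two copies of $F_i$: for $i=1$ replace them by $F_2$ ($1+1=2$); for $i=2$ replace them by $F_1,F_3$ ($2+2=1+3$); for $i\geq 3$ replace them by $F_{i-2},F_{i+1}$. The game ends when the list is the Zeckendorf decomposition of $n$ (a sum of distinct, pairwise non-consecutive Fibonacci numbers $F_i$); every game terminates. In the $p$-player game, players $1,2,\dots,p$ move in the cyclic order $1,2,\dots,p,1,2,\dots$, starting with player $1$; the player who makes the final move (creating the Zeckendorf decomposition) wins. A player has a winning strategy if he can choose his moves so that he makes the final move no matter what moves the other players make. -}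

module Defs where

open import Data.Nat using (ℕ; zero; suc; _+_; _∸_; _≤_; _<_; _≡ᵇ_; _<?_)
open import Data.Bool using (if_then_else_)
open import Data.Fin using (Fin; toℕ; fromℕ<)
open import Data.Product using (_×_)
open import Relation.Nullary using (¬_; yes; no)
open import Relation.Binary.PropositionalEquality using (_≢_)

-- A game position is a finitely supported multiset of Fibonacci numbers,
-- given by its multiplicity function: (c k) = number of copies of F_(k+1)
-- in the list (0-based index k stands for the paper's F_(k+1); F_1 = 1, F_2 = 2).
State : Set
State = ℕ → ℕ

inc : State → ℕ → State
inc c k j = if j ≡ᵇ k then suc (c j) else c j

dec : State → ℕ → State
dec c k j = if j ≡ᵇ k then c j ∸ 1 else c j

start : ℕ → State
start n j = if j ≡ᵇ 0 then n else 0

data Move (c : State) : State → Set where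
  -- F_(i-1), F_i  ↦  F_(i+1)   (here i-1 = k+1, i = k+2)
  combine : ∀ k → 1 ≤ c k → 1 ≤ c (suc k) →
            Move c (inc (dec (dec c k) (suc k)) (suc (suc k)))
  split1  : 2 ≤ c 0 → Move c (inc (dec (dec c 0) 0) 1)
  split2  : 2 ≤ c 1 → Move c (inc (inc (dec (dec c 1) 1) 0) 2)
  -- 2 F_i ↦ F_(i-2) + F_(i+1) for i ≥ 3   (here i = m+3)
  splitHi : ∀ m → 2 ≤ c (suc (suc m)) →
            Move c (inc (inc (dec (dec c (suc (suc m))) (suc (suc m))) m) (suc (suc (suc m))))

Zeck : State → Set
Zeck c = (∀ k → c k ≤ 1) × (∀ k → c k + c (suc k) ≤ 1)

-- cyclic successor on players 0,…,p-1 (player j here = paper's player j+1)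
next : ∀ {p} → Fin p → Fin p
next {suc q} i with suc (toℕ i) <? suc q
... | yes lt = fromℕ< lt
... | no _  = Fin.zero

-- Win p k j c : player k can force making the final move from position c
-- when player j is about to move (well-founded, since every game terminates).
data Win (p : ℕ) (k : Fin p) : Fin p → State → Set where
  finish : ∀ {c c'} → Move c c' → Zeck c' → Win p k k c
  mine   : ∀ {c c'} → Move c c' → ¬ Zeck c' → Win p k (next k) c' → Win p k k c
  theirs : ∀ {j c} → j ≢ k →
           (∀ c' → Move c c' → (¬ Zeck c') × Win p k (next j) c') → Win p k j c

-- player k has a winning strategy in the p-player game on n
-- (player 0, i.e. the paper's player 1, moves first)
HasWinningStrategy : (p n : ℕ) → Fin p → Set
HasWinningStrategy (suc q) n k = Win (suc q) k Fin.zero (start n)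

{-# OPTIONS --safe #-}
module Submission where

-- After the forced opening 1 + 1 ↦ 2 the game is at {1ⁿ⁻², 2}. Against any
-- player k we look for a position X, with two players j and next j other than k
-- to move in turn, from which some non-final position Y can be reached both in
-- one move by j and in two moves by j and next j (for instance 1 + 2 ↦ 3 versus
-- 1 + 1 ↦ 2, 2 + 2 ↦ 1 + 3). The two of them then decide whether Y is played
-- with next j or with next (next j) to move, and no strategy of k wins Y in both
-- cases. Such transpositions exist inside {1,1,2}, {1,2,2} and {1,2,3}; a short
-- look-ahead shows that k cannot avoid them, also in the three-player game where
-- the rotation brings k back quickly.

open import Defs
open import Data.Nat using (ℕ; zero; suc; _+_; _∸_; _≤_; _<?_; _≤?_; _≡ᵇ_; z≤n; s≤s)
open import Data.Nat.Properties
  using (≤-antisym; ≤-trans; ≤⇒≯; ≮⇒≥; ≰⇒>; m≤m+n; +-identityʳ; suc-injective; 1+n≢n; m≢1+n+m)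
open import Data.Bool using (true; false)
open import Data.Fin using (Fin; toℕ; _≟_)
open import Data.Fin.Properties using (toℕ-fromℕ<; toℕ-injective; toℕ<n)
open import Data.Product using (_×_; _,_; proj₁; proj₂; ∃)
open import Data.Sum using (_⊎_; inj₁; inj₂)
open import Data.Empty using (⊥-elim)
open import Function using (_∘_)
open import Relation.Nullary using (¬_; yes; no)
open import Relation.Binary.PropositionalEquality using (_≡_; _≢_; _≗_; refl; sym; trans; cong; cong₂; subst)

toℕ-next : ∀ {p} (i : Fin p) →
           toℕ (next i) ≡ suc (toℕ i) ⊎ (toℕ (next i) ≡ 0 × suc (toℕ i) ≡ p)
toℕ-next {suc q} i with suc (toℕ i) <? suc q
... | yes i+1<p = inj₁ (toℕ-fromℕ< i+1<p)
... | no  i+1≮p = inj₂ (refl , ≤-antisym (toℕ<n i) (≮⇒≥ i+1≮p))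

next-injective : ∀ {p} {i j : Fin p} → next i ≡ next j → i ≡ j
next-injective {i = i} {j} eq with toℕ-next i | toℕ-next j
... | inj₁ step-i | inj₁ step-j =
  toℕ-injective (suc-injective (trans (sym step-i) (trans (cong toℕ eq) step-j)))
... | inj₂ (_ , wrap-i) | inj₂ (_ , wrap-j) = toℕ-injective (suc-injective (trans wrap-i (sym wrap-j)))
... | inj₁ step-i | inj₂ (zero-j , _) with () ← trans (sym step-i) (trans (cong toℕ eq) zero-j)
... | inj₂ (zero-i , _) | inj₁ step-j with () ← trans (sym step-j) (trans (cong toℕ (sym eq)) zero-i)

next-irreflexive : ∀ {q} (i : Fin (2 + q)) → next i ≢ i
next-irreflexive i eq with toℕ-next i | cong toℕ eq
... | inj₁ step | e = 1+n≢n (trans (sym step) e)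
... | inj₂ (zero₁ , wrap) | e with () ← suc-injective (trans (sym (cong suc (trans (sym e) zero₁))) wrap)

next²-irreflexive : ∀ {q} (i : Fin (3 + q)) → next (next i) ≢ i
next²-irreflexive i eq with toℕ-next i | toℕ-next (next i) | cong toℕ eq
... | inj₁ step₁ | inj₁ step₂ | e = m≢1+n+m _ {1} (trans (sym e) (trans step₂ (cong suc step₁)))
... | inj₂ (zero₁ , wrap₁) | inj₁ step₂ | e
  with () ← trans (sym wrap₁) (cong suc (trans (sym e) (trans step₂ (cong suc zero₁))))
... | inj₁ step₁ | inj₂ (zero₂ , wrap₂) | e
  with () ← trans (sym wrap₂) (cong suc (trans step₁ (cong suc (trans (sym e) zero₂))))
... | inj₂ (zero₁ , _) | inj₂ (_ , wrap₂) | _ with () ← trans (sym wrap₂) (cong suc zero₁)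

inc-resp-≗ : ∀ {c d} k → c ≗ d → inc c k ≗ inc d k
inc-resp-≗ k c≗d j with j ≡ᵇ k
... | true  = cong suc (c≗d j)
... | false = c≗d j

dec-resp-≗ : ∀ {c d} k → c ≗ d → dec c k ≗ dec d k
dec-resp-≗ k c≗d j with j ≡ᵇ k
... | true  = cong (_∸ 1) (c≗d j)
... | false = c≗d j

Move-resp-≗ : ∀ {c c' d} → c ≗ d → Move c c' → ∃ λ d' → Move d d' × c' ≗ d'
Move-resp-≗ c≗d (combine k h h') =
  _ , combine k (subst (1 ≤_) (c≗d k) h) (subst (1 ≤_) (c≗d (suc k)) h') ,
  inc-resp-≗ _ (dec-resp-≗ _ (dec-resp-≗ k c≗d))
Move-resp-≗ c≗d (split1 h) =
  _ , split1 (subst (2 ≤_) (c≗d 0) h) , inc-resp-≗ 1 (dec-resp-≗ 0 (dec-resp-≗ 0 c≗d))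
Move-resp-≗ c≗d (split2 h) =
  _ , split2 (subst (2 ≤_) (c≗d 1) h) , inc-resp-≗ 2 (inc-resp-≗ 0 (dec-resp-≗ 1 (dec-resp-≗ 1 c≗d)))
Move-resp-≗ c≗d (splitHi m h) =
  _ , splitHi m (subst (2 ≤_) (c≗d (suc (suc m))) h) ,
  inc-resp-≗ _ (inc-resp-≗ m (dec-resp-≗ _ (dec-resp-≗ _ c≗d)))

Zeck-resp-≗ : ∀ {c d} → c ≗ d → Zeck c → Zeck d
Zeck-resp-≗ c≗d (single , adjacent) =
  (λ k → subst (_≤ 1) (c≗d k) (single k)) ,
  (λ k → subst (_≤ 1) (cong₂ _+_ (c≗d k) (c≗d (suc k))) (adjacent k))

Win-resp-≗ : ∀ {p k j c d} → c ≗ d → Win p k j c → Win p k j d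
Win-resp-≗ c≗d (finish mv z) with Move-resp-≗ c≗d mv
... | _ , mv' , c'≗d' = finish mv' (Zeck-resp-≗ c'≗d' z)
Win-resp-≗ c≗d (mine mv ¬z w) with Move-resp-≗ c≗d mv
... | _ , mv' , c'≗d' = mine mv' (¬z ∘ Zeck-resp-≗ (sym ∘ c'≗d')) (Win-resp-≗ c'≗d' w)
Win-resp-≗ c≗d (theirs j≢k all) = theirs j≢k λ d' mv → answer (Move-resp-≗ (sym ∘ c≗d) mv)
  where
  answer : ∀ {d'} → ∃ (λ c' → Move _ c' × d' ≗ c') → ¬ Zeck d' × Win _ _ _ d'
  answer (c' , mv , d'≗c') =
    proj₁ (all c' mv) ∘ Zeck-resp-≗ d'≗c' , Win-resp-≗ (sym ∘ d'≗c') (proj₂ (all c' mv))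

¬Zeck-adjacent : ∀ {c} i → 2 ≤ c i + c (suc i) → ¬ Zeck c
¬Zeck-adjacent i two (_ , adjacent) = ≤⇒≯ (adjacent i) two

stuck⇒Zeck : ∀ {c} → (∀ c' → ¬ Move c c') → Zeck c
stuck⇒Zeck {c} stuck = single , adjacent
  where
  single : ∀ i → c i ≤ 1
  single i with c i ≤? 1
  ... | yes ≤1 = ≤1
  single 0             | no ≰1 = ⊥-elim (stuck _ (split1 (≰⇒> ≰1)))
  single 1             | no ≰1 = ⊥-elim (stuck _ (split2 (≰⇒> ≰1)))
  single (suc (suc m)) | no ≰1 = ⊥-elim (stuck _ (splitHi m (≰⇒> ≰1)))
  adjacent : ∀ i → c i + c (suc i) ≤ 1
  adjacent i with c i in ci | c (suc i) in ci'
  ... | zero  | _ = subst (_≤ 1) ci' (single (suc i))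
  ... | suc x | zero rewrite +-identityʳ x = subst (_≤ 1) ci (single i)
  ... | suc _ | suc _ =
    ⊥-elim (stuck _ (combine i (subst (1 ≤_) (sym ci) (s≤s z≤n)) (subst (1 ≤_) (sym ci') (s≤s z≤n))))

-- Play both strategies along one common line: a move of k in one game is a move
-- of someone else in the other. The line ends with a move of k in both games,
-- although the players to move in the two games differ all along.
Win-unique-turn : ∀ {p k i j c} → ¬ Zeck c → Win p k i c → Win p k j c → ¬ i ≢ j
Win-unique-turn _ (finish _ _) (finish _ _) i≢j = i≢j refl
Win-unique-turn _ (finish _ _) (mine _ _ _) i≢j = i≢j refl
Win-unique-turn _ (mine _ _ _) (finish _ _) i≢j = i≢j refl
Win-unique-turn _ (mine _ _ _) (mine _ _ _) i≢j = i≢j refl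
Win-unique-turn _ (finish mv z) (theirs _ all) _ = proj₁ (all _ mv) z
Win-unique-turn _ (theirs _ all) (finish mv z) _ = proj₁ (all _ mv) z
Win-unique-turn _ (mine mv ¬z w) (theirs _ all) i≢j =
  Win-unique-turn ¬z w (proj₂ (all _ mv)) (i≢j ∘ next-injective)
Win-unique-turn _ (theirs _ all) (mine mv ¬z w) i≢j =
  Win-unique-turn ¬z (proj₂ (all _ mv)) w (i≢j ∘ next-injective)
Win-unique-turn ¬z (theirs _ all) (theirs _ all') i≢j = ¬z (stuck⇒Zeck λ c' mv →
  Win-unique-turn (proj₁ (all c' mv)) (proj₂ (all c' mv)) (proj₂ (all' c' mv)) (i≢j ∘ next-injective))

forcedMove : ∀ {p k j c c' d} → Move c c' → (∀ {c''} → Move c c'' → c'' ≗ d) → ¬ Zeck d →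
             Win p k j c → Win p k (next j) d
forcedMove _ only ¬z (finish mv z) = ⊥-elim (¬z (Zeck-resp-≗ (only mv) z))
forcedMove _ only _ (mine mv _ w) = Win-resp-≗ (only mv) w
forcedMove mv only _ (theirs _ all) = Win-resp-≗ (only mv) (proj₂ (all _ mv))

ownMove : ∀ {p k c} → Win p k k c → ∃ λ c' → Move c c' × (Zeck c' ⊎ Win p k (next k) c')
ownMove (finish mv z) = _ , mv , inj₁ z
ownMove (mine mv _ w) = _ , mv , inj₂ w
ownMove (theirs k≢k _) = ⊥-elim (k≢k refl)

resume : ∀ {p k j c' d} → c' ≗ d → ¬ Zeck d → Zeck c' ⊎ Win p k j c' → Win p k j d
resume c'≗d ¬z (inj₁ z) = ⊥-elim (¬z (Zeck-resp-≗ c'≗d z))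
resume c'≗d _ (inj₂ w) = Win-resp-≗ c'≗d w

_↝_ : State → State → Set
c ↝ d = ∃ λ c' → Move c c' × c' ≗ d

opponentMoves : ∀ {p k j c} → j ≢ k → Win p k j c →
                ∀ c' → Move c c' → ¬ Zeck c' × Win p k (next j) c'
opponentMoves k≢k (finish _ _) = ⊥-elim (k≢k refl)
opponentMoves k≢k (mine _ _ _) = ⊥-elim (k≢k refl)
opponentMoves _ (theirs _ all) = all

opponentMove-¬Zeck : ∀ {p k j c d} → j ≢ k → c ↝ d → Win p k j c → ¬ Zeck d
opponentMove-¬Zeck j≢k (c' , mv , c'≗d) w = proj₁ (opponentMoves j≢k w c' mv) ∘ Zeck-resp-≗ (sym ∘ c'≗d)

opponentMove-Win : ∀ {p k j c d} → j ≢ k → c ↝ d → Win p k j c → Win p k (next j) d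
opponentMove-Win j≢k (c' , mv , c'≗d) w = Win-resp-≗ c'≗d (proj₂ (opponentMoves j≢k w c' mv))

transposition : ∀ {q} {k j : Fin (2 + q)} {c x y} → j ≢ k → next j ≢ k →
                c ↝ y → c ↝ x → x ↝ y → ¬ Win (2 + q) k j c
transposition {j = j} j≢k next-j≢k c↝y c↝x x↝y w =
  Win-unique-turn (opponentMove-¬Zeck j≢k c↝y w)
    (opponentMove-Win j≢k c↝y w)
    (opponentMove-Win next-j≢k x↝y (opponentMove-Win j≢k c↝x w))
    (next-irreflexive (next j) ∘ sym)

-- pos a b c d e has a ones, b twos, c threes, d fives and e eights.
pos : ℕ → ℕ → ℕ → ℕ → ℕ → State
pos a _ _ _ _ 0 = a
pos _ b _ _ _ 1 = b
pos _ _ c _ _ 2 = c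
pos _ _ _ d _ 3 = d
pos _ _ _ _ e 4 = e
pos _ _ _ _ _ (suc (suc (suc (suc (suc _))))) = 0

pos-≗ : ∀ {c} → (∀ i → c (5 + i) ≡ 0) → c ≗ pos (c 0) (c 1) (c 2) (c 3) (c 4)
pos-≗ _ 0 = refl
pos-≗ _ 1 = refl
pos-≗ _ 2 = refl
pos-≗ _ 3 = refl
pos-≗ _ 4 = refl
pos-≗ tail (suc (suc (suc (suc (suc i))))) = tail i

Zeck-pos : ∀ {a b c d e} → a + b ≤ 1 → b + c ≤ 1 → c + d ≤ 1 → d + e ≤ 1 → e ≤ 1 →
           Zeck (pos a b c d e)
Zeck-pos {a} {b} {c} {d} {e} ab bc cd de e≤1 = single , adjacent
  where
  single : ∀ i → pos a b c d e i ≤ 1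
  single 0 = ≤-trans (m≤m+n a b) ab
  single 1 = ≤-trans (m≤m+n b c) bc
  single 2 = ≤-trans (m≤m+n c d) cd
  single 3 = ≤-trans (m≤m+n d e) de
  single 4 = e≤1
  single (suc (suc (suc (suc (suc _))))) = z≤n
  adjacent : ∀ i → pos a b c d e i + pos a b c d e (suc i) ≤ 1
  adjacent 0 = ab
  adjacent 1 = bc
  adjacent 2 = cd
  adjacent 3 = de
  adjacent 4 = subst (_≤ 1) (sym (+-identityʳ e)) e≤1
  adjacent (suc (suc (suc (suc (suc _))))) = z≤n

module _ {a b c d e : ℕ} where
  1+1↦2 : pos (2 + a) b c d e ↝ pos a (suc b) c d e
  1+1↦2 = _ , split1 (s≤s (s≤s z≤n)) , pos-≗ λ _ → refl

  1+2↦3 : pos (suc a) (suc b) c d e ↝ pos a b (suc c) d e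
  1+2↦3 = _ , combine 0 (s≤s z≤n) (s≤s z≤n) , pos-≗ λ _ → refl

  2+2↦1+3 : pos a (2 + b) c d e ↝ pos (suc a) b (suc c) d e
  2+2↦1+3 = _ , split2 (s≤s (s≤s z≤n)) , pos-≗ λ _ → refl

  2+3↦5 : pos a (suc b) (suc c) d e ↝ pos a b c (suc d) e
  2+3↦5 = _ , combine 1 (s≤s z≤n) (s≤s z≤n) , pos-≗ λ _ → refl

  3+3↦1+5 : pos a b (2 + c) d e ↝ pos (suc a) b c (suc d) e
  3+3↦1+5 = _ , splitHi 0 (s≤s (s≤s z≤n)) , pos-≗ λ _ → refl

  3+5↦8 : pos a b (suc c) (suc d) e ↝ pos a b c d (suc e)
  3+5↦8 = _ , combine 2 (s≤s z≤n) (s≤s z≤n) , pos-≗ λ _ → refl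

module _ {q : ℕ} {k j : Fin (2 + q)} {a b c d e : ℕ} (j≢k : j ≢ k) (next-j≢k : next j ≢ k) where
  ¬Win-⊇112 : ¬ Win (2 + q) k j (pos (2 + a) (suc b) c d e)
  ¬Win-⊇112 = transposition j≢k next-j≢k 1+2↦3 1+1↦2 2+2↦1+3

  ¬Win-⊇122 : ¬ Win (2 + q) k j (pos (suc a) (2 + b) c d e)
  ¬Win-⊇122 = transposition j≢k next-j≢k 1+2↦3 2+2↦1+3 1+1↦2

  ¬Win-⊇123 : ¬ Win (2 + q) k j (pos (suc a) (suc b) (suc c) d e)
  ¬Win-⊇123 = transposition j≢k next-j≢k 2+3↦5 1+2↦3 3+3↦1+5

moves-from-start : ∀ {m c'} → Move (start (5 + m)) c' → c' ≗ pos (3 + m) 1 0 0 0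
moves-from-start (combine _ _ ())
moves-from-start (split1 _) = pos-≗ λ _ → refl
moves-from-start (split2 ())
moves-from-start (splitHi _ ())

moves-from-1ᵐ⁺³2 : ∀ {m c'} → Move (pos (3 + m) 1 0 0 0) c' →
                   c' ≗ pos (2 + m) 0 1 0 0 ⊎ c' ≗ pos (1 + m) 2 0 0 0
moves-from-1ᵐ⁺³2 (combine 0 _ _) = inj₁ (pos-≗ λ _ → refl)
moves-from-1ᵐ⁺³2 (combine 1 _ ())
moves-from-1ᵐ⁺³2 (combine 2 () _)
moves-from-1ᵐ⁺³2 (combine 3 () _)
moves-from-1ᵐ⁺³2 (combine 4 () _)
moves-from-1ᵐ⁺³2 (combine (suc (suc (suc (suc (suc _))))) () _)
moves-from-1ᵐ⁺³2 (split1 _) = inj₂ (pos-≗ λ _ → refl)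
moves-from-1ᵐ⁺³2 (split2 (s≤s ()))
moves-from-1ᵐ⁺³2 (splitHi 0 ())
moves-from-1ᵐ⁺³2 (splitHi 1 ())
moves-from-1ᵐ⁺³2 (splitHi 2 ())
moves-from-1ᵐ⁺³2 (splitHi (suc (suc (suc _))) ())

moves-from-1ᵐ⁺²3 : ∀ {m c'} → Move (pos (2 + m) 0 1 0 0) c' → c' ≗ pos m 1 1 0 0
moves-from-1ᵐ⁺²3 (combine 0 _ ())
moves-from-1ᵐ⁺²3 (combine 1 () _)
moves-from-1ᵐ⁺²3 (combine 2 _ ())
moves-from-1ᵐ⁺²3 (combine 3 () _)
moves-from-1ᵐ⁺²3 (combine 4 () _)
moves-from-1ᵐ⁺²3 (combine (suc (suc (suc (suc (suc _))))) () _)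
moves-from-1ᵐ⁺²3 (split1 _) = pos-≗ λ _ → refl
moves-from-1ᵐ⁺²3 (split2 ())
moves-from-1ᵐ⁺²3 (splitHi 0 (s≤s ()))
moves-from-1ᵐ⁺²3 (splitHi 1 ())
moves-from-1ᵐ⁺²3 (splitHi 2 ())
moves-from-1ᵐ⁺²3 (splitHi (suc (suc (suc _))) ())

moves-from-1ᵐ⁺¹33 : ∀ {m c'} → Move (pos (1 + m) 0 2 0 0) c' →
                    c' ≗ pos (2 + m) 0 0 1 0 ⊎ ∃ λ r → m ≡ suc r × c' ≗ pos r 1 2 0 0
moves-from-1ᵐ⁺¹33 (combine 0 _ ())
moves-from-1ᵐ⁺¹33 (combine 1 () _)
moves-from-1ᵐ⁺¹33 (combine 2 _ ())
moves-from-1ᵐ⁺¹33 (combine 3 () _)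
moves-from-1ᵐ⁺¹33 (combine 4 () _)
moves-from-1ᵐ⁺¹33 (combine (suc (suc (suc (suc (suc _))))) () _)
moves-from-1ᵐ⁺¹33 {zero} (split1 (s≤s ()))
moves-from-1ᵐ⁺¹33 {suc r} (split1 _) = inj₂ (r , refl , pos-≗ λ _ → refl)
moves-from-1ᵐ⁺¹33 (split2 ())
moves-from-1ᵐ⁺¹33 (splitHi 0 _) = inj₁ (pos-≗ λ _ → refl)
moves-from-1ᵐ⁺¹33 (splitHi 1 ())
moves-from-1ᵐ⁺¹33 (splitHi 2 ())
moves-from-1ᵐ⁺¹33 (splitHi (suc (suc (suc _))) ())

opening : ∀ {p k j m} → Win p k j (start (5 + m)) → Win p k (next j) (pos (3 + m) 1 0 0 0)
opening = forcedMove (split1 (s≤s (s≤s z≤n))) moves-from-start (¬Zeck-adjacent 0 (s≤s (s≤s z≤n)))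

module _ {q : ℕ} where
  ¬Win-1ᵐ233 : ∀ m {k j : Fin (3 + q)} → j ≢ k → next j ≢ k → ¬ Win (3 + q) k j (pos m 1 2 0 0)
  ¬Win-1ᵐ233 zero j≢k next-j≢k w = opponentMove-¬Zeck next-j≢k 3+5↦8 (opponentMove-Win j≢k 2+3↦5 w)
                                      (Zeck-pos z≤n z≤n z≤n (s≤s z≤n) (s≤s z≤n))
  ¬Win-1ᵐ233 (suc m) = ¬Win-⊇123

  ¬Win-1ᵐ⁺¹33 : ∀ m {k : Fin (3 + q)} → Win (3 + q) k k (pos (2 + m) 0 0 1 0) →
                ¬ Win (3 + q) k k (pos (1 + m) 0 2 0 0)
  ¬Win-1ᵐ⁺¹33 m {k} w₅ w with ownMove w
  ... | _ , mv , result with moves-from-1ᵐ⁺¹33 mv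
  ... | inj₁ c'≗ = Win-unique-turn ¬Zeck-1ᵐ⁺²5 w₅ (resume c'≗ ¬Zeck-1ᵐ⁺²5 result) (next-irreflexive k ∘ sym)
    where
    ¬Zeck-1ᵐ⁺²5 : ¬ Zeck (pos (2 + m) 0 0 1 0)
    ¬Zeck-1ᵐ⁺²5 = ¬Zeck-adjacent 0 (s≤s (s≤s z≤n))
  ... | inj₂ (r , refl , c'≗) = ¬Win-1ᵐ233 r (next-irreflexive k) (next²-irreflexive k)
                                  (resume c'≗ (¬Zeck-adjacent 1 (s≤s (s≤s z≤n))) result)

  ¬Win-1ᵐ23 : ∀ m {k j : Fin (3 + q)} → j ≢ k → ¬ Win (3 + q) k j (pos m 1 1 0 0)
  ¬Win-1ᵐ23 0 j≢k w = opponentMove-¬Zeck j≢k 2+3↦5 w (Zeck-pos z≤n z≤n (s≤s z≤n) (s≤s z≤n) z≤n)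
  ¬Win-1ᵐ23 1 j≢k w = opponentMove-¬Zeck j≢k 2+3↦5 w (Zeck-pos (s≤s z≤n) z≤n (s≤s z≤n) (s≤s z≤n) z≤n)
  ¬Win-1ᵐ23 (suc (suc m)) {k} {j} j≢k w with next j ≟ k
  ... | no next-j≢k = ¬Win-⊇112 j≢k next-j≢k w
  ... | yes refl = ¬Win-1ᵐ⁺¹33 m (opponentMove-Win j≢k 2+3↦5 w) (opponentMove-Win j≢k 1+2↦3 w)

  ¬Win-1ᵐ⁺²3 : ∀ m {k j : Fin (3 + q)} → next j ≢ k → ¬ Win (3 + q) k j (pos (2 + m) 0 1 0 0)
  ¬Win-1ᵐ⁺²3 m next-j≢k =
    ¬Win-1ᵐ23 m next-j≢k
    ∘ forcedMove (split1 (s≤s (s≤s z≤n))) moves-from-1ᵐ⁺²3 (¬Zeck-adjacent 1 (s≤s (s≤s z≤n)))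

  ¬Win-own-1ᵐ⁺³2 : ∀ m {k : Fin (3 + q)} → ¬ Win (3 + q) k k (pos (3 + m) 1 0 0 0)
  ¬Win-own-1ᵐ⁺³2 m {k} w with ownMove w
  ... | _ , mv , result with moves-from-1ᵐ⁺³2 mv
  ... | inj₁ c'≗ = ¬Win-1ᵐ⁺²3 m (next²-irreflexive k)
                     (resume c'≗ (¬Zeck-adjacent 0 (s≤s (s≤s z≤n))) result)
  ... | inj₂ c'≗ = ¬Win-⊇122 (next-irreflexive k) (next²-irreflexive k)
                     (resume c'≗ (¬Zeck-adjacent 1 (s≤s (s≤s z≤n))) result)

  ¬Win-1ᵐ⁺³2 : ∀ m {k j : Fin (3 + q)} → ¬ Win (3 + q) k j (pos (3 + m) 1 0 0 0)
  ¬Win-1ᵐ⁺³2 m {k} {j} with j ≟ k | next j ≟ k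
  ... | yes refl | _ = ¬Win-own-1ᵐ⁺³2 m
  ... | no j≢k | yes refl = ¬Win-1ᵐ⁺²3 m (next-irreflexive (next j)) ∘ opponentMove-Win j≢k 1+2↦3
  ... | no j≢k | no next-j≢k = ¬Win-⊇112 j≢k next-j≢k

theorem1p3p1 : (n p : ℕ) → 5 ≤ n → 3 ≤ p → (k : Fin p) → ¬ HasWinningStrategy p n k
theorem1p3p1 _ _ (s≤s (s≤s (s≤s (s≤s (s≤s {n = m} _))))) (s≤s (s≤s (s≤s _))) _ =
  ¬Win-1ᵐ⁺³2 m ∘ opening
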